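{- For every consistent formula $\varphi\in\mathcal{L}$ (i.e. $\neg\varphi$ is not derivable, $\not\vdash\neg\varphi$), there exist a WTS $\mathcal{M}=(S,\rightarrow,\ell)$ with $S$ finite and a state $s\in S$ such that $\mathcal{M},s\models\varphi$.
   Context: Fix a countable set $\mathcal{AP}$ of atomic propositions. A weighted transition system (WTS) is a triple $\mathcal{M}=(S,\rightarrow,\ell)$ where $S$ is a non-empty set of states, $\rightarrow\subseteq S\times\mathbb{R}_{\ge 0}\times S$ is a transition relation (write $s\xrightarrow{r}t$), and $\ell:S\to 2^{\mathcal{AP}}$ is a labeling. For $s\in S$, $T\subseteq S$ let $\theta(s)(T)=\{r\mid \exists t\in T,\ s\xrightarrow{r}t\}$; $\theta^-(s)(T)=-\infty$ if $\theta(s)(T)=\emptyset$, else $\inf\theta(s)(T)$; $\theta^+(s)(T)=\infty$ if $\theta(s)(T)=\emptyset$, else $\sup\theta(s)(T)$. Formulae of $\mathcal{L}$: $\varphi::= p\mid\neg\varphi\mid\varphi\wedge\varphi\mid L_r\varphi\mid M_r\varphi$ with $p\in\mathcal{AP}$, $r\in\mathbb{Q}_{\ge0}$; $\bot,\vee,\to,\leftrightarrow$ defined as usual. Semantics: $\mathcal{M},s\models p$ iff $p\in\ell(s)$; Boolean cases as usual; $\mathcal{M},s\models L_r\varphi$ iff $\theta^-(s)([\![\varphi]\!])\ge r$; $\mathcal{M},s\models M_r\varphi$ iff $\theta^+(s)([\![\varphi]\!])\le r$, where $[\![\varphi]\!]$ is the set of states satisfying $\varphi$. Axiomatic system: $\vdash\varphi$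 means $\varphi$ belongs to the smallest set of formulae containing all instances of propositional tautologies and of the axioms below, closed under modus ponens and the rules below (all $r,q\in\mathbb{Q}_{\ge0}$): (A1) $\neg L_0\bot$; (A2) $L_{r+q}\varphi\to L_r\varphi$ if $q>0$; (A2$'$) $M_r\varphi\to M_{r+q}\varphi$ if $q>0$; (A3) $L_r\varphi\wedge L_q\psi\to L_{\min\{r,q\}}(\varphi\vee\psi)$; (A3$'$) $M_r\varphi\wedge M_q\psi\to M_{\max\{r,q\}}(\varphi\vee\psi)$; (A4) $L_r(\varphi\vee\psi)\to L_r\varphi\vee L_r\psi$; (A5) $\neg L_0\psi\to(L_r\varphi\to L_r(\varphi\vee\psi))$; (A5$'$) $\neg L_0\psi\to(M_r\varphi\to M_r(\varphi\vee\psi))$; (A6) $L_{r+q}\varphi\to\neg M_r\varphi$ if $q>0$; (A7) $M_r\varphi\to L_0\varphi$; (R1) from $\vdash\varphi\to\psi$ infer $\vdash(L_r\psi\wedge L_0\varphi)\to L_r\varphi$; (R1$'$) from $\vdash\varphi\to\psi$ infer $\vdash(M_r\psi\wedge L_0\varphi)\to M_r\varphi$; (R2) from $\vdash\varphi\to\psi$ infer $\vdash L_0\varphi\to L_0\psi$. A formula $\varphi$ is consistent if $\bot$ cannot be derived from it, i.e. $\not\vdash\neg\varphi$. -}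

module Defs where

open import Data.Nat using (ℕ; zero)
open import Data.Fin using (Fin)
open import Data.Bool using (Bool; true; false; not; _∧_)
import Data.Rational.Properties
open import Data.Rational using (ℚ; 0ℚ; _≤_; _<_; _+_; _⊓_; _⊔_)
open import Data.Product using (Σ; Σ-syntax; _×_; _,_; proj₁)
open import Relation.Binary.PropositionalEquality using (_≡_)
open import Relation.Nullary using (¬_)
open import Level using (0ℓ) renaming (suc to lsuc)

ℚ≥0 : Set
ℚ≥0 = Σ ℚ (λ r → 0ℚ ≤ r)

val : ℚ≥0 → ℚ
val = proj₁

data Form : Set where
  atom : ℕ → Form
  neg  : Form → Form
  and  : Form → Form → Form
  L    : ℚ≥0 → Form → Form
  M    : ℚ≥0 → Form → Form

fls : Form
fls = and (atom zero) (neg (atom zero))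

or : Form → Form → Form
or φ ψ = neg (and (neg φ) (neg ψ))

imp : Form → Form → Form
imp φ ψ = neg (and φ (neg ψ))

-- Propositional tautologies: formulae true under every Boolean valuation
-- of their maximal non-Boolean subformulae (atoms and L/M-formulae).

beval : (Form → Bool) → Form → Bool
beval v (atom p)  = v (atom p)
beval v (neg φ)   = not (beval v φ)
beval v (and φ ψ) = beval v φ ∧ beval v ψ
beval v (L r φ)   = v (L r φ)
beval v (M r φ)   = v (M r φ)

Tautology : Form → Set
Tautology φ = (v : Form → Bool) → beval v φ ≡ true

-- The axiomatic system.  r + q, min, max are expressed by an index whose
-- value equals the corresponding rational.

data ⊢_ : Form → Set where
  taut : ∀ {φ} → Tautology φ → ⊢ φ
  A1   : ⊢ neg (L (0ℚ , Data.Rational.Properties.≤-refl) fls)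
  A2   : ∀ (r q s : ℚ≥0) φ → val s ≡ val r + val q → 0ℚ < val q →
         ⊢ imp (L s φ) (L r φ)
  A2′  : ∀ (r q s : ℚ≥0) φ → val s ≡ val r + val q → 0ℚ < val q →
         ⊢ imp (M r φ) (M s φ)
  A3   : ∀ (r q m : ℚ≥0) φ ψ → val m ≡ val r ⊓ val q →
         ⊢ imp (and (L r φ) (L q ψ)) (L m (or φ ψ))
  A3′  : ∀ (r q m : ℚ≥0) φ ψ → val m ≡ val r ⊔ val q →
         ⊢ imp (and (M r φ) (M q ψ)) (M m (or φ ψ))
  A4   : ∀ r φ ψ → ⊢ imp (L r (or φ ψ)) (or (L r φ) (L r ψ))
  A5   : ∀ (z r : ℚ≥0) φ ψ → val z ≡ 0ℚ →
         ⊢ imp (neg (L z ψ)) (imp (L r φ) (L r (or φ ψ)))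
  A5′  : ∀ (z r : ℚ≥0) φ ψ → val z ≡ 0ℚ →
         ⊢ imp (neg (L z ψ)) (imp (M r φ) (M r (or φ ψ)))
  A6   : ∀ (r q s : ℚ≥0) φ → val s ≡ val r + val q → 0ℚ < val q →
         ⊢ imp (L s φ) (neg (M r φ))
  A7   : ∀ (z r : ℚ≥0) φ → val z ≡ 0ℚ → ⊢ imp (M r φ) (L z φ)
  mp   : ∀ {φ ψ} → ⊢ imp φ ψ → ⊢ φ → ⊢ ψ
  R1   : ∀ (z r : ℚ≥0) {φ ψ} → val z ≡ 0ℚ → ⊢ imp φ ψ →
         ⊢ imp (and (L r ψ) (L z φ)) (L r φ)
  R1′  : ∀ (z r : ℚ≥0) {φ ψ} → val z ≡ 0ℚ → ⊢ imp φ ψ →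
         ⊢ imp (and (M r ψ) (L z φ)) (M r φ)
  R2   : ∀ (z : ℚ≥0) {φ ψ} → val z ≡ 0ℚ → ⊢ imp φ ψ →
         ⊢ imp (L z φ) (L z ψ)

Consistent : Form → Set
Consistent φ = ¬ (⊢ neg φ)

record FinWTS : Set₁ where
  field
    n     : ℕ
    _─[_]→_ : Fin n → ℚ → Fin n → Set
    nonneg  : ∀ {s w t} → s ─[ w ]→ t → 0ℚ ≤ w
    ℓ     : Fin n → ℕ → Bool

open FinWTS public

-- Satisfaction.  θ⁻(s)(⟦φ⟧) ≥ r  iff  some φ-successor exists and every
-- weight into ⟦φ⟧ is ≥ r  (θ⁻ = -∞ on the empty set);
-- θ⁺(s)(⟦φ⟧) ≤ r  iff  some φ-successor exists and every weight into ⟦φ⟧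
-- is ≤ r  (θ⁺ = ∞ on the empty set).

_∣_⊨_ : (𝓜 : FinWTS) → Fin (n 𝓜) → Form → Set
𝓜 ∣ s ⊨ atom p  = ℓ 𝓜 s p ≡ true
𝓜 ∣ s ⊨ neg φ   = ¬ (𝓜 ∣ s ⊨ φ)
𝓜 ∣ s ⊨ and φ ψ = (𝓜 ∣ s ⊨ φ) × (𝓜 ∣ s ⊨ ψ)
𝓜 ∣ s ⊨ L r φ   =
  (Σ[ t ∈ Fin (n 𝓜) ] Σ[ w ∈ ℚ ] (_─[_]→_ 𝓜 s w t × (𝓜 ∣ t ⊨ φ))) ×
  (∀ t w → _─[_]→_ 𝓜 s w t → 𝓜 ∣ t ⊨ φ → val r ≤ w)
𝓜 ∣ s ⊨ M r φ   =
  (Σ[ t ∈ Fin (n 𝓜) ] Σ[ w ∈ ℚ ] (_─[_]→_ 𝓜 s w t × (𝓜 ∣ t ⊨ φ))) ×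
  (∀ t w → _─[_]→_ 𝓜 s w t → 𝓜 ∣ t ⊨ φ → w ≤ val r)

-- The proof is a decision procedure: by induction on modal depth, every
-- formula gets a finite tree model or a derivation of its negation.  A
-- formula is put in disjunctive normal form; for a conjunction D of
-- literals, the arguments of its modal literals span 2^k sign patterns
-- (cells).  Each cell that is satisfiable (by induction), not excluded by a
-- literal ¬L0 ψ, and whose tightest lower bound is at most its tightest
-- upper bound becomes a successor of the root, weighted by both bounds.
-- Every literal of D then holds at the root, or its failure is turned by
-- the axioms into a refutation of D: unusable cells provably have no
-- successors, usable ones provably respect the relevant bounds, and A3-A5
-- combine this over the disjunction of cells.  The tree is finally
-- flattened into a finite WTS; consistency excludes the refutation.

module Submission where

open import Defs
open import Data.Bool using (Bool; true; false; not; _∧_; T)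
open import Data.Bool.Properties using (∧-conicalˡ; ∧-conicalʳ; ∧-assoc; not-injective; T-≡)
open import Data.Empty using (⊥; ⊥-elim)
open import Data.Fin using (Fin; zero; suc; #_)
import Data.Fin.Properties as Fin
open import Data.Fin.Subset using (Subset; inside; outside) renaming (_∈_ to _∈ₛ_; _∉_ to _∉ₛ_)
open import Data.Fin.Subset.Properties using (anySubset?) renaming (_∈?_ to _∈ₛ?_)
open import Data.List as List using (List; []; _∷_; _++_; cartesianProductWith)
import Data.List.Extrema
open import Data.List.Membership.Propositional using (_∈_; lose)
open import Data.List.Membership.Propositional.Properties
  using (∈-lookup; ∈-++⁺ˡ; ∈-++⁺ʳ; ∈-++⁻; ∈-map⁺; ∈-map⁻; ∈-filter⁺; ∈-filter⁻;
         ∈-concatMap⁺; ∈-concatMap⁻; ∈-cartesianProductWith⁺; ∈-cartesianProductWith⁻)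
open import Data.List.Relation.Unary.All using (All; []; _∷_)
import Data.List.Relation.Unary.All as All
open import Data.List.Relation.Unary.Any using (here; there)
import Data.List.Relation.Unary.Any as Any
open import Data.List.Relation.Unary.Any.Properties using (lookup-index)
open import Data.Nat using (ℕ; zero; suc) renaming (_≤_ to _≤ℕ_; _<_ to _<ℕ_; _⊔_ to _⊔ℕ_)
import Data.Nat as ℕ
import Data.Nat.Properties as ℕ
open import Data.List.Membership.DecPropositional ℕ._≟_ using () renaming (_∈?_ to _∈ℕ?_)
open import Data.Product using (Σ-syntax; ∃; _×_; _,_; proj₁; proj₂)
open import Data.Rational using (ℚ; 0ℚ; 1ℚ; _≤_; _<_; _+_; _-_; -_; _⊔_)
import Data.Rational.Properties as ℚ
open import Data.Sum using (_⊎_; inj₁; inj₂)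
open import Data.Unit using (⊤; tt)
open import Data.Vec using (Vec; []; _∷_; lookup; map)
open import Data.Vec.Base using (here; there)
open import Data.Vec.Properties using (lookup-map)
open import Function using (_∘_; id; case_of_)
open import Function.Bundles using (Equivalence)
open import Relation.Binary.Bundles using (DecTotalOrder)
open import Relation.Binary.Definitions using (tri<; tri≈; tri>)
open import Relation.Binary.PropositionalEquality
open import Relation.Nullary using (Dec; yes; no; does; ¬_; ¬?; _×-dec_)
open import Relation.Nullary.Decidable using (True; dec-true; decidable-stable)

module Extrema = Data.List.Extrema (DecTotalOrder.totalOrder ℚ.≤-decTotalOrder)

-- Propositional schemata: formulae over variables Fin k.  A schema valid
-- under all 2^k valuations yields, under any instantiation of its
-- variables by formulae, an instance of a tautology.

data Schema (k : ℕ) : Set where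
  var  : Fin k → Schema k
  ¬ˢ_  : Schema k → Schema k
  _∧ˢ_ : Schema k → Schema k → Schema k
  ⊥ˢ   : Schema k

infixr 6 _⇒_
infixr 7 _∨ˢ_
infixr 8 _∧ˢ_
infix 9 ¬ˢ_

_⇒_ _∨ˢ_ : ∀ {k} → Schema k → Schema k → Schema k
a ⇒ b  = ¬ˢ (a ∧ˢ ¬ˢ b)
a ∨ˢ b = ¬ˢ (¬ˢ a ∧ˢ ¬ˢ b)

v : ∀ {k} m {m<k : True (m ℕ.<? k)} → Schema k
v m {m<k} = var (#_ m {m<n = m<k})

instantiate : ∀ {k} → Schema k → Vec Form k → Form
instantiate (var i)   fs = lookup fs i
instantiate (¬ˢ a)    fs = neg (instantiate a fs)
instantiate (a ∧ˢ b)  fs = and (instantiate a fs) (instantiate b fs)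
instantiate ⊥ˢ        fs = fls

evalˢ : ∀ {k} → Schema k → Vec Bool k → Bool
evalˢ (var i)  bs = lookup bs i
evalˢ (¬ˢ a)   bs = not (evalˢ a bs)
evalˢ (a ∧ˢ b) bs = evalˢ a bs ∧ evalˢ b bs
evalˢ ⊥ˢ       bs = false

beval-fls : ∀ w → beval w fls ≡ false
beval-fls w with w (atom zero)
... | true  = refl
... | false = refl

⊤F : Form
⊤F = neg fls

beval-⊤F : ∀ w → beval w ⊤F ≡ true
beval-⊤F w = cong not (beval-fls w)

beval-instantiate : ∀ {k} w (a : Schema k) fs →
                    beval w (instantiate a fs) ≡ evalˢ a (map (beval w) fs)
beval-instantiate w (var i)  fs = sym (lookup-map i (beval w) fs)
beval-instantiate w (¬ˢ a)   fs = cong not (beval-instantiate w a fs)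
beval-instantiate w (a ∧ˢ b) fs = cong₂ _∧_ (beval-instantiate w a fs) (beval-instantiate w b fs)
beval-instantiate w ⊥ˢ       fs = beval-fls w

everyValuation : ∀ k → (Vec Bool k → Bool) → Bool
everyValuation zero    f = f []
everyValuation (suc k) f =
  everyValuation k (λ bs → f (true ∷ bs)) ∧ everyValuation k (λ bs → f (false ∷ bs))

everyValuation-sound : ∀ k f → everyValuation k f ≡ true → ∀ bs → f bs ≡ true
everyValuation-sound zero    f ok [] = ok
everyValuation-sound (suc k) f ok (true ∷ bs)  = everyValuation-sound k _ (∧-conicalˡ _ _ ok) bs
everyValuation-sound (suc k) f ok (false ∷ bs) = everyValuation-sound k _ (∧-conicalʳ _ _ ok) bs

Valid : ∀ {k} → Schema k → Set
Valid {k} a = T (everyValuation k (evalˢ a))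

valid-instance : ∀ {k} (a : Schema k) → Valid a → (fs : Vec Form k) → ⊢ instantiate a fs
valid-instance {k} a ok fs = taut λ w →
  trans (beval-instantiate w a fs) (everyValuation-sound k (evalˢ a) (Equivalence.to T-≡ ok) _)

_⇛_ : ∀ {k} → List (Schema k) → Schema k → Schema k
[]       ⇛ c = c
(h ∷ hs) ⇛ c = h ⇒ (hs ⇛ c)

byTaut : ∀ {k} (hs : List (Schema k)) (c : Schema k) {ok : Valid (hs ⇛ c)} (fs : Vec Form k) →
         All (λ h → ⊢ instantiate h fs) hs → ⊢ instantiate c fs
byTaut hs c {ok} fs = go hs (valid-instance (hs ⇛ c) ok fs)
  where
  go : ∀ hs → ⊢ instantiate (hs ⇛ c) fs → All (λ h → ⊢ instantiate h fs) hs → ⊢ instantiate c fs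
  go []       ⊢c     []         = ⊢c
  go (h ∷ hs) ⊢h⇒hsc (⊢h ∷ ⊢hs) = go hs (mp ⊢h⇒hsc ⊢h) ⊢hs

imp-taut : ∀ {φ ψ} → (∀ w → beval w φ ≡ true → beval w ψ ≡ true) → ⊢ imp φ ψ
imp-taut {φ} {ψ} entails = taut λ w → check w (beval w φ) refl
  where
  check : ∀ w b → beval w φ ≡ b → beval w (imp φ ψ) ≡ true
  check w false φ≡b rewrite φ≡b = refl
  check w true  φ≡b rewrite φ≡b | entails w φ≡b = refl

∧-intro : ∀ {a b} → a ≡ true → b ≡ true → a ∧ b ≡ true
∧-intro a≡true b≡true = cong₂ _∧_ a≡true b≡true

infix 2 _⊩_
_⊩_ : Form → Form → Set
G ⊩ a = ⊢ imp G a

weaken : ∀ {G a} → ⊢ a → G ⊩ a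
weaken {G} {a} ⊢a = byTaut (v 0 ∷ []) (v 1 ⇒ v 0) (a ∷ G ∷ []) (⊢a ∷ [])

⊩-mp : ∀ {G a b} → ⊢ imp a b → G ⊩ a → G ⊩ b
⊩-mp {G} {a} {b} a⇒b G⊩a =
  byTaut (v 1 ⇒ v 2 ∷ v 0 ⇒ v 1 ∷ []) (v 0 ⇒ v 2) (G ∷ a ∷ b ∷ []) (a⇒b ∷ G⊩a ∷ [])

⊩-inl : ∀ {G a b} → G ⊩ a → G ⊩ or a b
⊩-inl {G} {a} {b} = ⊩-mp (byTaut [] (v 0 ⇒ v 0 ∨ˢ v 1) (a ∷ b ∷ []) [])

⊩-fst : ∀ {G a b} → G ⊩ and a b → G ⊩ a
⊩-fst {G} {a} {b} = ⊩-mp (byTaut [] (v 0 ∧ˢ v 1 ⇒ v 0) (a ∷ b ∷ []) [])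

⊩-snd : ∀ {G a b} → G ⊩ and a b → G ⊩ b
⊩-snd {G} {a} {b} = ⊩-mp (byTaut [] (v 0 ∧ˢ v 1 ⇒ v 1) (a ∷ b ∷ []) [])

⊩-contra : ∀ {G a} → G ⊩ a → G ⊩ neg a → G ⊩ fls
⊩-contra {G} {a} G⊩a G⊩¬a =
  byTaut (v 0 ⇒ v 1 ∷ v 0 ⇒ ¬ˢ v 1 ∷ []) (v 0 ⇒ ⊥ˢ) (G ∷ a ∷ []) (G⊩a ∷ G⊩¬a ∷ [])

⊩-refute : ∀ {G} → G ⊩ fls → ⊢ neg G
⊩-refute {G} G⊩fls = byTaut (v 0 ⇒ ⊥ˢ ∷ []) (¬ˢ v 0) (G ∷ []) (G⊩fls ∷ [])

-- The index 0; L0 φ says that some φ-successor exists.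
z0 : ℚ≥0
z0 = 0ℚ , ℚ.≤-refl

L0 : Form → Form
L0 = L z0

index-≡ : ∀ {r s : ℚ≥0} → val r ≡ val s → r ≡ s
index-≡ {r , p} {.r , q} refl = cong (r ,_) (ℚ.≤-irrelevant p q)

L0-refute : ∀ {φ} → ⊢ neg φ → ⊢ neg (L0 φ)
L0-refute {φ} ⊢¬φ = byTaut (v 0 ⇒ v 1 ∷ ¬ˢ v 1 ∷ []) (¬ˢ v 0) (L0 φ ∷ L0 fls ∷ [])
  (R2 z0 refl φ⇒fls ∷ A1 ∷ [])
  where
  φ⇒fls : ⊢ imp φ fls
  φ⇒fls = byTaut (¬ˢ v 0 ∷ []) (v 0 ⇒ ⊥ˢ) (φ ∷ []) (⊢¬φ ∷ [])

-- a strict increase of indices r < s splits as s = r + q with q > 0,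
-- which is the form in which A2, A2′ and A6 are stated
split-< : ∀ (r s : ℚ≥0) → val r < val s → Σ[ q ∈ ℚ≥0 ] (val s ≡ val r + val q × 0ℚ < val q)
split-< (r , _) (s , _) r<s = (s - r , ℚ.<⇒≤ 0<s-r) , sym r+[s-r]≡s , 0<s-r
  where
  open ≡-Reasoning
  0<s-r : 0ℚ < s - r
  0<s-r = subst (_< s - r) (ℚ.+-inverseʳ r) (ℚ.+-monoˡ-< (- r) r<s)
  r+[s-r]≡s : r + (s - r) ≡ s
  r+[s-r]≡s = begin
    r + (s - r)   ≡⟨ cong (r +_) (ℚ.+-comm s (- r)) ⟩
    r + (- r + s) ≡⟨ sym (ℚ.+-assoc r (- r) s) ⟩
    (r - r) + s   ≡⟨ cong (_+ s) (ℚ.+-inverseʳ r) ⟩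
    0ℚ + s        ≡⟨ ℚ.+-identityˡ s ⟩
    s             ∎

≤-split : ∀ (r s : ℚ≥0) → val r ≤ val s → val r < val s ⊎ r ≡ s
≤-split r s r≤s with ℚ.<-cmp (val r) (val s)
... | tri< r<s _ _ = inj₁ r<s
... | tri≈ _ r≡s _ = inj₂ (index-≡ r≡s)
... | tri> _ _ s<r = ⊥-elim (ℚ.<-irrefl refl (ℚ.<-≤-trans s<r r≤s))

L-antitone : ∀ {r s : ℚ≥0} φ → val r ≤ val s → ⊢ imp (L s φ) (L r φ)
L-antitone {r} {s} φ r≤s with ≤-split r s r≤s
... | inj₁ r<s = let (q , s≡r+q , 0<q) = split-< r s r<s in A2 r q s φ s≡r+q 0<q
... | inj₂ refl = byTaut [] (v 0 ⇒ v 0) (L r φ ∷ []) []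

M-monotone : ∀ {r s : ℚ≥0} φ → val r ≤ val s → ⊢ imp (M r φ) (M s φ)
M-monotone {r} {s} φ r≤s with ≤-split r s r≤s
... | inj₁ r<s = let (q , s≡r+q , 0<q) = split-< r s r<s in A2′ r q s φ s≡r+q 0<q
... | inj₂ refl = byTaut [] (v 0 ⇒ v 0) (M r φ ∷ []) []

LM-exclusive : ∀ {r s : ℚ≥0} φ → val r < val s → ⊢ imp (L s φ) (neg (M r φ))
LM-exclusive {r} {s} φ r<s = let (q , s≡r+q , 0<q) = split-< r s r<s in A6 r q s φ s≡r+q 0<q

data Kind : Set where
  lower upper : Kind

K : Kind → ℚ≥0 → Form → Form
K lower = L
K upper = M

infix 4 _≼⟨_⟩_
_≼⟨_⟩_ : ℚ → Kind → ℚ → Set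
x ≼⟨ lower ⟩ y = x ≤ y
x ≼⟨ upper ⟩ y = y ≤ x

≼-trans : ∀ κ {x y z} → x ≼⟨ κ ⟩ y → y ≼⟨ κ ⟩ z → x ≼⟨ κ ⟩ z
≼-trans lower x≤y y≤z = ℚ.≤-trans x≤y y≤z
≼-trans upper y≤x z≤y = ℚ.≤-trans z≤y y≤x

≼-dec : ∀ κ x y → Dec (x ≼⟨ κ ⟩ y)
≼-dec lower x y = x ℚ.≤? y
≼-dec upper x y = y ℚ.≤? x

K-weaken : ∀ κ {r s : ℚ≥0} φ → val r ≼⟨ κ ⟩ val s → ⊢ imp (K κ s φ) (K κ r φ)
K-weaken lower φ r≤s = L-antitone φ r≤s
K-weaken upper φ s≤r = M-monotone φ s≤r

K-L0 : ∀ κ r φ → ⊢ imp (K κ r φ) (L0 φ)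
K-L0 lower r φ = L-antitone φ (proj₂ r)
K-L0 upper r φ = A7 z0 r φ refl

K-restrict : ∀ κ r {φ ψ} → ⊢ imp φ ψ → ⊢ imp (and (K κ r ψ) (L0 φ)) (K κ r φ)
K-restrict lower r φ⇒ψ = R1 z0 r refl φ⇒ψ
K-restrict upper r φ⇒ψ = R1′ z0 r refl φ⇒ψ

K-join : ∀ κ r φ ψ → ⊢ imp (and (K κ r φ) (K κ r ψ)) (K κ r (or φ ψ))
K-join lower r φ ψ = A3 r r r φ ψ (sym (ℚ.⊓-idem (val r)))
K-join upper r φ ψ = A3′ r r r φ ψ (sym (ℚ.⊔-idem (val r)))

K-absorb : ∀ κ r φ ψ → ⊢ imp (neg (L0 ψ)) (imp (K κ r φ) (K κ r (or φ ψ)))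
K-absorb lower r φ ψ = A5 z0 r φ ψ refl
K-absorb upper r φ ψ = A5′ z0 r φ ψ refl

K-cong : ∀ κ r {φ ψ} → ⊢ imp φ ψ → ⊢ imp ψ φ → ⊢ imp (K κ r ψ) (K κ r φ)
K-cong κ r {φ} {ψ} φ⇒ψ ψ⇒φ =
  byTaut (v 0 ⇒ v 1 ∷ v 1 ⇒ v 2 ∷ v 0 ∧ˢ v 2 ⇒ v 3 ∷ []) (v 0 ⇒ v 3)
    (K κ r ψ ∷ L0 ψ ∷ L0 φ ∷ K κ r φ ∷ [])
    (K-L0 κ r ψ ∷ R2 z0 refl ψ⇒φ ∷ K-restrict κ r φ⇒ψ ∷ [])

⋁ : List Form → Form
⋁ []       = fls
⋁ (X ∷ Xs) = or X (⋁ Xs)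

beval-⋁ : ∀ w {X} Xs → X ∈ Xs → beval w X ≡ true → beval w (⋁ Xs) ≡ true
beval-⋁ w (X ∷ Xs) (here refl) X≡true rewrite X≡true = refl
beval-⋁ w (Y ∷ Xs) (there X∈Xs) X≡true rewrite beval-⋁ w Xs X∈Xs X≡true
  with beval w Y
... | true  = refl
... | false = refl

⋁-refute : ∀ Xs → (∀ {X} → X ∈ Xs → ⊢ neg X) → ⊢ neg (⋁ Xs)
⋁-refute []       _       = byTaut [] (¬ˢ ⊥ˢ) [] []
⋁-refute (X ∷ Xs) each =
  byTaut (¬ˢ v 0 ∷ ¬ˢ v 1 ∷ []) (¬ˢ (v 0 ∨ˢ v 1)) (X ∷ ⋁ Xs ∷ [])
    (each (here refl) ∷ ⋁-refute Xs (each ∘ there) ∷ [])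

⋁-void : ∀ G Xs → (∀ {X} → X ∈ Xs → G ⊩ neg (L0 X)) → G ⊩ neg (L0 (⋁ Xs))
⋁-void G []       _    = weaken A1
⋁-void G (X ∷ Xs) void =
  byTaut (v 3 ⇒ v 1 ∨ˢ v 2 ∷ v 0 ⇒ ¬ˢ v 1 ∷ v 0 ⇒ ¬ˢ v 2 ∷ []) (v 0 ⇒ ¬ˢ v 3)
    (G ∷ L0 X ∷ L0 (⋁ Xs) ∷ L0 (or X (⋁ Xs)) ∷ [])
    (A4 z0 X (⋁ Xs) ∷ void (here refl) ∷ ⋁-void G Xs (void ∘ there) ∷ [])

-- if every disjunct has no successor or respects the κ-bound r, so does
-- the disjunction: a case analysis over the first disjunct and the rest,
-- using A4 (both void), K-absorb (one void) and K-join (neither void)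
⋁-bound : ∀ κ G r Xs → (∀ {X} → X ∈ Xs → G ⊩ or (neg (L0 X)) (K κ r X)) →
          G ⊩ or (neg (L0 (⋁ Xs))) (K κ r (⋁ Xs))
⋁-bound κ G r [] _ =
  byTaut (¬ˢ v 1 ∷ []) (v 0 ⇒ ¬ˢ v 1 ∨ˢ v 2) (G ∷ L0 fls ∷ K κ r fls ∷ []) (A1 ∷ [])
⋁-bound κ G r (X ∷ Xs) each =
  byTaut (v 0 ⇒ ¬ˢ v 1 ∨ˢ v 3 ∷ v 0 ⇒ ¬ˢ v 2 ∨ˢ v 4 ∷ v 5 ⇒ v 1 ∨ˢ v 2 ∷
          ¬ˢ v 2 ⇒ v 3 ⇒ v 6 ∷ ¬ˢ v 1 ⇒ v 4 ⇒ v 6 ∷ v 3 ∧ˢ v 4 ⇒ v 6 ∷ [])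
    (v 0 ⇒ ¬ˢ v 5 ∨ˢ v 6)
    (G ∷ L0 X ∷ L0 D ∷ K κ r X ∷ K κ r D ∷ L0 (or X D) ∷ K κ r (or X D) ∷ [])
    (each (here refl) ∷ ⋁-bound κ G r Xs (each ∘ there) ∷ A4 z0 X D ∷
     K-absorb κ r X D ∷ absorb-first ∷ K-join κ r X D ∷ [])
  where
  D = ⋁ Xs
  swap : ∀ a b → ⊢ imp (or a b) (or b a)
  swap a b = byTaut [] (v 0 ∨ˢ v 1 ⇒ v 1 ∨ˢ v 0) (a ∷ b ∷ []) []
  absorb-first : ⊢ imp (neg (L0 X)) (imp (K κ r D) (K κ r (or X D)))
  absorb-first =
    byTaut (v 0 ⇒ v 1 ⇒ v 2 ∷ v 2 ⇒ v 3 ∷ []) (v 0 ⇒ v 1 ⇒ v 3)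
      (neg (L0 X) ∷ K κ r D ∷ K κ r (or D X) ∷ K κ r (or X D) ∷ [])
      (K-absorb κ r D X ∷ K-cong κ r (swap X D) (swap D X) ∷ [])

-- G asserts a successor of ψ, but ψ entails X and G denies successors of X
refute-void : ∀ {G ψ X} → G ⊩ L0 ψ → ⊢ imp ψ X → G ⊩ neg (L0 X) → G ⊩ fls
refute-void {G} {ψ} {X} G⊩L0ψ ψ⇒X G⊩¬L0X =
  byTaut (v 0 ⇒ v 1 ∷ v 1 ⇒ v 2 ∷ v 0 ⇒ ¬ˢ v 2 ∷ []) (v 0 ⇒ ⊥ˢ)
    (G ∷ L0 ψ ∷ L0 X ∷ []) (G⊩L0ψ ∷ R2 z0 refl ψ⇒X ∷ G⊩¬L0X ∷ [])

-- G asserts a successor of ψ and denies the κ-bound r of ψ; but ψ entails X,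
-- which (having a successor) must respect the bound, and the bound passes
-- back to ψ by K-restrict
refute-bound : ∀ κ r {G ψ X} → G ⊩ L0 ψ → G ⊩ neg (K κ r ψ) → ⊢ imp ψ X →
               G ⊩ or (neg (L0 X)) (K κ r X) → G ⊩ fls
refute-bound κ r {G} {ψ} {X} G⊩L0ψ G⊩¬Kψ ψ⇒X G⊩X =
  byTaut (v 0 ⇒ v 1 ∷ v 0 ⇒ ¬ˢ v 2 ∷ v 1 ⇒ v 3 ∷ v 4 ∧ˢ v 1 ⇒ v 2 ∷
          v 0 ⇒ ¬ˢ v 3 ∨ˢ v 4 ∷ [])
    (v 0 ⇒ ⊥ˢ)
    (G ∷ L0 ψ ∷ K κ r ψ ∷ L0 X ∷ K κ r X ∷ [])
    (G⊩L0ψ ∷ G⊩¬Kψ ∷ R2 z0 refl ψ⇒X ∷ K-restrict κ r ψ⇒X ∷ G⊩X ∷ [])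

data Tree : Set where
  node : (ℕ → Bool) → List (ℚ≥0 × Tree) → Tree

label : Tree → ℕ → Bool
label (node ℓ _) = ℓ

children : Tree → List (ℚ≥0 × Tree)
children (node _ cs) = cs

leaf : Tree
leaf = node (λ _ → false) []

Graded : (Tree → Set) → (ℚ → Set) → Tree → Set
Graded P R t = (Σ[ e ∈ ℚ≥0 × Tree ] (e ∈ children t × P (proj₂ e))) ×
               (∀ e → e ∈ children t → P (proj₂ e) → R (val (proj₁ e)))

infix 4 _⊨ᵗ_
_⊨ᵗ_ : Tree → Form → Set
t ⊨ᵗ atom p  = label t p ≡ true
t ⊨ᵗ neg φ   = ¬ (t ⊨ᵗ φ)
t ⊨ᵗ and φ ψ = t ⊨ᵗ φ × t ⊨ᵗ ψ
t ⊨ᵗ L r φ   = Graded (_⊨ᵗ φ) (val r ≤_) t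
t ⊨ᵗ M r φ   = Graded (_⊨ᵗ φ) (_≤ val r) t

K-graded : ∀ κ {r φ t} → t ⊨ᵗ K κ r φ → Graded (_⊨ᵗ φ) (val r ≼⟨ κ ⟩_) t
K-graded lower sat = sat
K-graded upper sat = sat

graded-K : ∀ κ {r φ t} → Graded (_⊨ᵗ φ) (val r ≼⟨ κ ⟩_) t → t ⊨ᵗ K κ r φ
graded-K lower sat = sat
graded-K upper sat = sat

-- L0 φ holds iff some child satisfies φ (weights are nonnegative)
L0-intro : ∀ {φ t e} → e ∈ children t → proj₂ e ⊨ᵗ φ → t ⊨ᵗ L0 φ
L0-intro {e = e} e∈t e⊨φ = (e , e∈t , e⊨φ) , λ e′ _ _ → proj₂ (proj₁ e′)

K-L0-sem : ∀ κ {r φ t} → t ⊨ᵗ K κ r φ → t ⊨ᵗ L0 φ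
K-L0-sem κ {t = t} sat with K-graded κ sat
... | (e , e∈t , e⊨φ) , _ = L0-intro {t = t} e∈t e⊨φ

⊨-⊤F : ∀ t → t ⊨ᵗ ⊤F
⊨-⊤F t (⊨p , ⊨¬p) = ⊨¬p ⊨p

data Verdict (φ : Form) : Set where
  model   : (t : Tree) → t ⊨ᵗ φ → Verdict φ
  refuted : ⊢ neg φ → Verdict φ

Satisfiable : ∀ {φ} → Verdict φ → Set
Satisfiable (model _ _) = ⊤
Satisfiable (refuted _) = ⊥

satisfiable? : ∀ {φ} (r : Verdict φ) → Dec (Satisfiable r)
satisfiable? (model _ _) = yes tt
satisfiable? (refuted _) = no λ ()

treeOf : ∀ {φ} → Verdict φ → Tree
treeOf (model t _) = t
treeOf (refuted _) = leaf

treeOf-⊨ : ∀ {φ} (r : Verdict φ) → Satisfiable r → treeOf r ⊨ᵗ φ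
treeOf-⊨ (model _ t⊨φ) _ = t⊨φ

refutation : ∀ {φ} (r : Verdict φ) → ¬ Satisfiable r → ⊢ neg φ
refutation (model _ _)  unsat = ⊥-elim (unsat tt)
refutation (refuted ⊢¬φ) _    = ⊢¬φ

-- Every formula is Boolean-equivalent to a disjunction of
-- conjunctions of literals; a negated modality  ¬ K κ r ψ  splits into
-- "ψ has no successor" and "ψ has a successor but the bound fails".
data MLit : Set where
  bound   : Kind → ℚ≥0 → Form → MLit
  unbound : Kind → ℚ≥0 → Form → MLit
  void    : Form → MLit

data Lit : Set where
  posAtom negAtom : ℕ → Lit
  modal           : MLit → Lit

arg : MLit → Form
arg (bound _ _ ψ)   = ψ
arg (unbound _ _ ψ) = ψ
arg (void ψ)        = ψ

index : MLit → ℚ≥0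
index (bound _ r _)   = r
index (unbound _ r _) = r
index (void _)        = z0

mlitF : MLit → Form
mlitF (bound κ r ψ)   = K κ r ψ
mlitF (unbound κ r ψ) = and (L0 ψ) (neg (K κ r ψ))
mlitF (void ψ)        = neg (L0 ψ)

litF : Lit → Form
litF (posAtom p) = atom p
litF (negAtom p) = neg (atom p)
litF (modal m)   = mlitF m

conj : List Lit → Form
conj []      = ⊤F
conj (x ∷ D) = and (litF x) (conj D)

DNF : Set
DNF = List (List Lit)

_⊗_ : DNF → DNF → DNF
_⊗_ = cartesianProductWith _++_

dnf⁺ dnf⁻ : Form → DNF
dnf⁺ (atom p)  = (posAtom p ∷ []) ∷ []
dnf⁺ (neg φ)   = dnf⁻ φ
dnf⁺ (and φ ψ) = dnf⁺ φ ⊗ dnf⁺ ψ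
dnf⁺ (L r φ)   = (modal (bound lower r φ) ∷ []) ∷ []
dnf⁺ (M r φ)   = (modal (bound upper r φ) ∷ []) ∷ []
dnf⁻ (atom p)  = (negAtom p ∷ []) ∷ []
dnf⁻ (neg φ)   = dnf⁺ φ
dnf⁻ (and φ ψ) = dnf⁻ φ ++ dnf⁻ ψ
dnf⁻ (L r φ)   = (modal (void φ) ∷ []) ∷ (modal (unbound lower r φ) ∷ []) ∷ []
dnf⁻ (M r φ)   = (modal (void φ) ∷ []) ∷ (modal (unbound upper r φ) ∷ []) ∷ []

SomeTrue : (Form → Bool) → DNF → Set
SomeTrue w Ds = Σ[ D ∈ List Lit ] (D ∈ Ds × beval w (conj D) ≡ true)

beval-conj-++ : ∀ w D E → beval w (conj (D ++ E)) ≡ beval w (conj D) ∧ beval w (conj E)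
beval-conj-++ w []      E = sym (cong (_∧ beval w (conj E)) (beval-⊤F w))
beval-conj-++ w (x ∷ D) E rewrite beval-conj-++ w D E =
  sym (∧-assoc (beval w (litF x)) (beval w (conj D)) (beval w (conj E)))

single : ∀ w x {Ds} → beval w (litF x) ≡ true → SomeTrue w ((x ∷ []) ∷ Ds)
single w x x≡true = x ∷ [] , here refl , ∧-intro x≡true (beval-⊤F w)

negModal-complete : ∀ w κ r φ → beval w (K κ r φ) ≡ false →
  SomeTrue w ((modal (void φ) ∷ []) ∷ (modal (unbound κ r φ) ∷ []) ∷ [])
negModal-complete w κ r φ Kφ≡false with w (L0 φ) in L0φ≡
... | false = single w (modal (void φ)) (cong not L0φ≡)
... | true  = modal (unbound κ r φ) ∷ [] , there (here refl) ,
              ∧-intro (∧-intro L0φ≡ (cong not Kφ≡false)) (beval-⊤F w)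

dnf⁺-complete : ∀ w φ → beval w φ ≡ true  → SomeTrue w (dnf⁺ φ)
dnf⁻-complete : ∀ w φ → beval w φ ≡ false → SomeTrue w (dnf⁻ φ)
dnf⁺-complete w (atom p) φ≡true = single w (posAtom p) φ≡true
dnf⁺-complete w (neg φ) φ≡true = dnf⁻-complete w φ (not-injective φ≡true)
dnf⁺-complete w (and φ ψ) φψ≡true
  with dnf⁺-complete w φ (∧-conicalˡ _ _ φψ≡true) | dnf⁺-complete w ψ (∧-conicalʳ _ _ φψ≡true)
... | D , D∈ , D≡true | E , E∈ , E≡true =
  D ++ E , ∈-cartesianProductWith⁺ _++_ D∈ E∈ , trans (beval-conj-++ w D E) (∧-intro D≡true E≡true)
dnf⁺-complete w (L r φ) φ≡true = single w (modal (bound lower r φ)) φ≡true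
dnf⁺-complete w (M r φ) φ≡true = single w (modal (bound upper r φ)) φ≡true
dnf⁻-complete w (atom p) φ≡false = single w (negAtom p) (cong not φ≡false)
dnf⁻-complete w (neg φ) φ≡false = dnf⁺-complete w φ (not-injective φ≡false)
dnf⁻-complete w (and φ ψ) φψ≡false with beval w φ in φ≡
... | false = let D , D∈ , D≡true = dnf⁻-complete w φ φ≡ in D , ∈-++⁺ˡ D∈ , D≡true
... | true  = let D , D∈ , D≡true = dnf⁻-complete w ψ φψ≡false
              in  D , ∈-++⁺ʳ (dnf⁻ φ) D∈ , D≡true
dnf⁻-complete w (L r φ) φ≡false = negModal-complete w lower r φ φ≡false
dnf⁻-complete w (M r φ) φ≡false = negModal-complete w upper r φ φ≡false

dnf-refute : ∀ φ → (∀ {D} → D ∈ dnf⁺ φ → ⊢ neg (conj D)) → ⊢ neg φ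
dnf-refute φ disjunct-refuted = byTaut (v 0 ⇒ v 1 ∷ ¬ˢ v 1 ∷ []) (¬ˢ v 0) (φ ∷ ⋁ Cs ∷ [])
  (imp-taut covered ∷ ⋁-refute Cs each ∷ [])
  where
  Cs = List.map conj (dnf⁺ φ)
  covered : ∀ w → beval w φ ≡ true → beval w (⋁ Cs) ≡ true
  covered w φ≡true with dnf⁺-complete w φ φ≡true
  ... | D , D∈ , D≡true = beval-⋁ w Cs (∈-map⁺ conj D∈) D≡true
  each : ∀ {X} → X ∈ Cs → ⊢ neg X
  each X∈ with ∈-map⁻ conj X∈
  ... | D , D∈ , refl = disjunct-refuted D∈

conj-++⁻ : ∀ D {E t} → t ⊨ᵗ conj (D ++ E) → t ⊨ᵗ conj D × t ⊨ᵗ conj E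
conj-++⁻ []      {t = t} ⊨E         = ⊨-⊤F t , ⊨E
conj-++⁻ (x ∷ D)         (⊨x , ⊨DE) = let ⊨D , ⊨E = conj-++⁻ D ⊨DE in (⊨x , ⊨D) , ⊨E

negModal-sound : ∀ κ r φ {D t} → D ∈ (modal (void φ) ∷ []) ∷ (modal (unbound κ r φ) ∷ []) ∷ [] →
                 t ⊨ᵗ conj D → ¬ t ⊨ᵗ K κ r φ
negModal-sound κ r φ (here refl)         (¬L0φ , _)      Kφ = ¬L0φ (K-L0-sem κ Kφ)
negModal-sound κ r φ (there (here refl)) ((_ , ¬Kφ) , _) Kφ = ¬Kφ Kφ

dnf⁺-sound : ∀ φ {D t} → D ∈ dnf⁺ φ → t ⊨ᵗ conj D → t ⊨ᵗ φ
dnf⁻-sound : ∀ φ {D t} → D ∈ dnf⁻ φ → t ⊨ᵗ conj D → ¬ t ⊨ᵗ φ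
dnf⁺-sound (atom p) (here refl) (⊨p , _) = ⊨p
dnf⁺-sound (neg φ) D∈ ⊨D = dnf⁻-sound φ D∈ ⊨D
dnf⁺-sound (and φ ψ) F∈ ⊨F with ∈-cartesianProductWith⁻ _++_ (dnf⁺ φ) (dnf⁺ ψ) F∈
... | D , E , D∈ , E∈ , refl =
  let ⊨D , ⊨E = conj-++⁻ D ⊨F in dnf⁺-sound φ D∈ ⊨D , dnf⁺-sound ψ E∈ ⊨E
dnf⁺-sound (L r φ) (here refl) (⊨Lφ , _) = ⊨Lφ
dnf⁺-sound (M r φ) (here refl) (⊨Mφ , _) = ⊨Mφ
dnf⁻-sound (atom p) (here refl) (⊨¬p , _) = ⊨¬p
dnf⁻-sound (neg φ) D∈ ⊨D ⊨¬φ = ⊨¬φ (dnf⁺-sound φ D∈ ⊨D)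
dnf⁻-sound (and φ ψ) D∈ ⊨D with ∈-++⁻ (dnf⁻ φ) D∈
... | inj₁ D∈φ = λ (⊨φ , _) → dnf⁻-sound φ D∈φ ⊨D ⊨φ
... | inj₂ D∈ψ = λ (_ , ⊨ψ) → dnf⁻-sound ψ D∈ψ ⊨D ⊨ψ
dnf⁻-sound (L r φ) D∈ ⊨D = negModal-sound lower r φ D∈ ⊨D
dnf⁻-sound (M r φ) D∈ ⊨D = negModal-sound upper r φ D∈ ⊨D

-- Modal depth; the literals of the DNF of φ are at most as deep as φ, so
-- the formulae under their modalities are strictly shallower.
depth : Form → ℕ
depth (atom p)  = 0
depth (neg φ)   = depth φ
depth (and φ ψ) = depth φ ⊔ℕ depth ψ
depth (L r φ)   = suc (depth φ)
depth (M r φ)   = suc (depth φ)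

litDepth : Lit → ℕ
litDepth (posAtom _) = 0
litDepth (negAtom _) = 0
litDepth (modal m)   = suc (depth (arg m))

dnf⁺-depth : ∀ φ {D x} → D ∈ dnf⁺ φ → x ∈ D → litDepth x ≤ℕ depth φ
dnf⁻-depth : ∀ φ {D x} → D ∈ dnf⁻ φ → x ∈ D → litDepth x ≤ℕ depth φ
dnf⁺-depth (atom p) (here refl) (here refl) = ℕ.z≤n
dnf⁺-depth (neg φ) D∈ x∈ = dnf⁻-depth φ D∈ x∈
dnf⁺-depth (and φ ψ) F∈ x∈ with ∈-cartesianProductWith⁻ _++_ (dnf⁺ φ) (dnf⁺ ψ) F∈
... | D , E , D∈ , E∈ , refl with ∈-++⁻ D x∈
...   | inj₁ x∈D = ℕ.≤-trans (dnf⁺-depth φ D∈ x∈D) (ℕ.m≤m⊔n (depth φ) (depth ψ))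
...   | inj₂ x∈E = ℕ.≤-trans (dnf⁺-depth ψ E∈ x∈E) (ℕ.m≤n⊔m (depth φ) (depth ψ))
dnf⁺-depth (L r φ) (here refl) (here refl) = ℕ.≤-refl
dnf⁺-depth (M r φ) (here refl) (here refl) = ℕ.≤-refl
dnf⁻-depth (atom p) (here refl) (here refl) = ℕ.z≤n
dnf⁻-depth (neg φ) D∈ x∈ = dnf⁺-depth φ D∈ x∈
dnf⁻-depth (and φ ψ) D∈ x∈ with ∈-++⁻ (dnf⁻ φ) D∈
... | inj₁ D∈φ = ℕ.≤-trans (dnf⁻-depth φ D∈φ x∈) (ℕ.m≤m⊔n (depth φ) (depth ψ))
... | inj₂ D∈ψ = ℕ.≤-trans (dnf⁻-depth ψ D∈ψ x∈) (ℕ.m≤n⊔m (depth φ) (depth ψ))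
dnf⁻-depth (L r φ) (here refl)         (here refl) = ℕ.≤-refl
dnf⁻-depth (L r φ) (there (here refl)) (here refl) = ℕ.≤-refl
dnf⁻-depth (M r φ) (here refl)         (here refl) = ℕ.≤-refl
dnf⁻-depth (M r φ) (there (here refl)) (here refl) = ℕ.≤-refl

conj-elim : ∀ D {x} → x ∈ D → conj D ⊩ litF x
conj-elim (y ∷ D) (here refl) = byTaut [] (v 0 ∧ˢ v 1 ⇒ v 0) (litF y ∷ conj D ∷ []) []
conj-elim (y ∷ D) {x} (there x∈D) =
  byTaut (v 1 ⇒ v 2 ∷ []) (v 0 ∧ˢ v 1 ⇒ v 2) (litF y ∷ conj D ∷ litF x ∷ []) (conj-elim D x∈D ∷ [])

conj-intro : ∀ t D {Failure : Set} →
             (∀ {x} → x ∈ D → t ⊨ᵗ litF x ⊎ Failure) → t ⊨ᵗ conj D ⊎ Failure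
conj-intro t []      _     = inj₁ (⊨-⊤F t)
conj-intro t (x ∷ D) check with check (here refl) | conj-intro t D (check ∘ there)
... | inj₁ t⊨x | inj₁ t⊨D = inj₁ (t⊨x , t⊨D)
... | inj₂ fail | _        = inj₂ fail
... | inj₁ _    | inj₂ fail = inj₂ fail

modalLits : List Lit → List MLit
modalLits []              = []
modalLits (posAtom _ ∷ D) = modalLits D
modalLits (negAtom _ ∷ D) = modalLits D
modalLits (modal m ∷ D)   = m ∷ modalLits D

modalLits⁺ : ∀ D {m} → modal m ∈ D → m ∈ modalLits D
modalLits⁺ (posAtom _ ∷ D) (there m∈) = modalLits⁺ D m∈
modalLits⁺ (negAtom _ ∷ D) (there m∈) = modalLits⁺ D m∈
modalLits⁺ (modal _ ∷ D)   (here refl) = here refl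
modalLits⁺ (modal _ ∷ D)   (there m∈) = there (modalLits⁺ D m∈)

modalLits⁻ : ∀ D {m} → m ∈ modalLits D → modal m ∈ D
modalLits⁻ (posAtom _ ∷ D) m∈ = there (modalLits⁻ D m∈)
modalLits⁻ (negAtom _ ∷ D) m∈ = there (modalLits⁻ D m∈)
modalLits⁻ (modal _ ∷ D)   (here refl) = here refl
modalLits⁻ (modal _ ∷ D)   (there m∈) = there (modalLits⁻ D m∈)

posAtoms : List Lit → List ℕ
posAtoms []              = []
posAtoms (posAtom p ∷ D) = p ∷ posAtoms D
posAtoms (negAtom _ ∷ D) = posAtoms D
posAtoms (modal _ ∷ D)   = posAtoms D

posAtoms⁺ : ∀ D {p} → posAtom p ∈ D → p ∈ posAtoms D
posAtoms⁺ (posAtom _ ∷ D) (here refl) = here refl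
posAtoms⁺ (posAtom _ ∷ D) (there p∈) = there (posAtoms⁺ D p∈)
posAtoms⁺ (negAtom _ ∷ D) (there p∈) = posAtoms⁺ D p∈
posAtoms⁺ (modal _ ∷ D)   (there p∈) = posAtoms⁺ D p∈

posAtoms⁻ : ∀ D {p} → p ∈ posAtoms D → posAtom p ∈ D
posAtoms⁻ (posAtom _ ∷ D) (here refl) = here refl
posAtoms⁻ (posAtom _ ∷ D) (there p∈) = there (posAtoms⁻ D p∈)
posAtoms⁻ (negAtom _ ∷ D) p∈ = there (posAtoms⁻ D p∈)
posAtoms⁻ (modal _ ∷ D)   p∈ = there (posAtoms⁻ D p∈)

-- For a list ms of modal literals, a cell is a subset σ of their
-- positions; χ ms σ asserts the arguments at positions in σ and denies
-- the others.  The cells partition the Boolean possibilities for the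
-- arguments, so every successor of a node lies in exactly one cell.
Cell : List MLit → Set
Cell ms = Subset (List.length ms)

signed : Bool → Form → Form
signed inside  ψ = ψ
signed outside ψ = neg ψ

χ : (ms : List MLit) → Cell ms → Form
χ []       []      = ⊤F
χ (m ∷ ms) (b ∷ σ) = and (signed b (arg m)) (χ ms σ)

argAt : (ms : List MLit) → Fin (List.length ms) → Form
argAt ms j = arg (List.lookup ms j)

χ-proves : ∀ ms {σ j} → j ∈ₛ σ → ⊢ imp (χ ms σ) (argAt ms j)
χ-proves (m ∷ ms) {inside ∷ σ} here =
  byTaut [] (v 0 ∧ˢ v 1 ⇒ v 0) (arg m ∷ χ ms σ ∷ []) []
χ-proves (m ∷ ms) {b ∷ σ} {suc j} (there j∈σ) =
  byTaut (v 1 ⇒ v 2 ∷ []) (v 0 ∧ˢ v 1 ⇒ v 2) (signed b (arg m) ∷ χ ms σ ∷ argAt ms j ∷ [])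
    (χ-proves ms j∈σ ∷ [])

χ-in : ∀ ms {σ j t} → t ⊨ᵗ χ ms σ → j ∈ₛ σ → t ⊨ᵗ argAt ms j
χ-in (m ∷ ms) {inside ∷ σ} (⊨ψ , _) here          = ⊨ψ
χ-in (m ∷ ms) {b ∷ σ}      (_ , ⊨χ) (there j∈σ) = χ-in ms ⊨χ j∈σ

χ-out : ∀ ms {σ j t} → t ⊨ᵗ χ ms σ → j ∉ₛ σ → ¬ t ⊨ᵗ argAt ms j
χ-out (m ∷ ms) {inside ∷ σ}  {zero}  _         j∉σ = ⊥-elim (j∉σ here)
χ-out (m ∷ ms) {outside ∷ σ} {zero}  (⊨¬ψ , _) _   = ⊨¬ψ
χ-out (m ∷ ms) {b ∷ σ}       {suc j} (_ , ⊨χ)  j∉σ = χ-out ms ⊨χ (j∉σ ∘ there)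

χ-depth : ∀ {d} ms σ → (∀ j → depth (argAt ms j) <ℕ d) → 0 <ℕ d → depth (χ ms σ) <ℕ d
χ-depth []       []            _       0<d = 0<d
χ-depth (m ∷ ms) (inside ∷ σ)  shallow 0<d =
  ℕ.⊔-pres-<m (shallow zero) (χ-depth ms σ (shallow ∘ suc) 0<d)
χ-depth (m ∷ ms) (outside ∷ σ) shallow 0<d =
  ℕ.⊔-pres-<m (shallow zero) (χ-depth ms σ (shallow ∘ suc) 0<d)

allSubsets : ∀ k → List (Subset k)
allSubsets zero    = [] ∷ []
allSubsets (suc k) = List.map (inside ∷_) (allSubsets k) ++ List.map (outside ∷_) (allSubsets k)

allSubsets-complete : ∀ {k} (σ : Subset k) → σ ∈ allSubsets k
allSubsets-complete [] = here refl
allSubsets-complete (inside ∷ σ) = ∈-++⁺ˡ (∈-map⁺ (inside ∷_) (allSubsets-complete σ))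
allSubsets-complete {suc k} (outside ∷ σ) =
  ∈-++⁺ʳ (List.map (inside ∷_) (allSubsets k)) (∈-map⁺ (outside ∷_) (allSubsets-complete σ))

cellsWith : ∀ ms → Fin (List.length ms) → List (Cell ms)
cellsWith ms j = List.filter (j ∈ₛ?_) (allSubsets _)

signature : (Form → Bool) → (ms : List MLit) → Cell ms
signature w []       = []
signature w (m ∷ ms) = beval w (arg m) ∷ signature w ms

χ-signature : ∀ w ms → beval w (χ ms (signature w ms)) ≡ true
χ-signature w []       = beval-⊤F w
χ-signature w (m ∷ ms) = ∧-intro (signed-beval (beval w (arg m)) refl) (χ-signature w ms)
  where
  signed-beval : ∀ b → beval w (arg m) ≡ b → beval w (signed b (arg m)) ≡ true
  signed-beval true  ψ≡b = ψ≡b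
  signed-beval false ψ≡b = cong not ψ≡b

signature-∈ : ∀ w ms j → beval w (argAt ms j) ≡ true → j ∈ₛ signature w ms
signature-∈ w (m ∷ ms) zero    ψ≡true rewrite ψ≡true = here
signature-∈ w (m ∷ ms) (suc j) ψ≡true = there (signature-∈ w ms j ψ≡true)

cover : ∀ ms j → ⊢ imp (argAt ms j) (⋁ (List.map (χ ms) (cellsWith ms j)))
cover ms j = imp-taut λ w ψ≡true →
  beval-⋁ w _
    (∈-map⁺ (χ ms) (∈-filter⁺ (j ∈ₛ?_) (allSubsets-complete _) (signature-∈ w ms j ψ≡true)))
    (χ-signature w ms)

-- Bounds.  The κ-bounds imposed by the literals whose arguments a cell
-- asserts; a successor in that cell must respect all of them.
imposes : Kind → MLit → List ℚ≥0
imposes lower (bound lower r _) = r ∷ []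
imposes upper (bound upper r _) = r ∷ []
imposes _     _                 = []

imposedBy : Kind → (ms : List MLit) → Cell ms → List ℚ≥0
imposedBy κ []       []            = []
imposedBy κ (m ∷ ms) (inside  ∷ σ) = imposes κ m ++ imposedBy κ ms σ
imposedBy κ (m ∷ ms) (outside ∷ σ) = imposedBy κ ms σ

imposes-bound : ∀ κ {r ψ} → imposes κ (bound κ r ψ) ≡ r ∷ []
imposes-bound lower = refl
imposes-bound upper = refl

imposedBy⁺ : ∀ κ ms {σ j r ψ} → j ∈ₛ σ → List.lookup ms j ≡ bound κ r ψ → r ∈ imposedBy κ ms σ
imposedBy⁺ κ (m ∷ ms) {inside ∷ σ} {r = r} {ψ} here refl rewrite imposes-bound κ {r} {ψ} = here refl
imposedBy⁺ κ (m ∷ ms) {inside ∷ σ} (there j∈σ) m≡ =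
  ∈-++⁺ʳ (imposes κ m) (imposedBy⁺ κ ms j∈σ m≡)
imposedBy⁺ κ (m ∷ ms) {outside ∷ σ} (there j∈σ) m≡ = imposedBy⁺ κ ms j∈σ m≡

ImposedAt : Kind → (ms : List MLit) → Cell ms → ℚ≥0 → Set
ImposedAt κ ms σ r = Σ[ j ∈ Fin (List.length ms) ] Σ[ ψ ∈ Form ]
                       (j ∈ₛ σ × List.lookup ms j ≡ bound κ r ψ)

imposes⁻ : ∀ κ m {r} → r ∈ imposes κ m → Σ[ ψ ∈ Form ] (m ≡ bound κ r ψ)
imposes⁻ lower (bound lower r ψ) (here refl) = ψ , refl
imposes⁻ upper (bound upper r ψ) (here refl) = ψ , refl

imposedBy⁻ : ∀ κ ms {σ r} → r ∈ imposedBy κ ms σ → ImposedAt κ ms σ r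
imposedBy⁻ κ [] {[]} ()
imposedBy⁻ κ (m ∷ ms) {inside ∷ σ} r∈ with ∈-++⁻ (imposes κ m) r∈
... | inj₁ r∈m  = let ψ , m≡ = imposes⁻ κ m r∈m in zero , ψ , here , m≡
... | inj₂ r∈ms = let j , ψ , j∈σ , m≡ = imposedBy⁻ κ ms r∈ms in suc j , ψ , there j∈σ , m≡
imposedBy⁻ κ (m ∷ ms) {outside ∷ σ} r∈ =
  let j , ψ , j∈σ , m≡ = imposedBy⁻ κ ms r∈ in suc j , ψ , there j∈σ , m≡

-- an index strictly above every index occurring in ms
maxIndex : List MLit → ℚ
maxIndex []       = 0ℚ
maxIndex (m ∷ ms) = val (index m) ⊔ maxIndex ms

ceiling : List MLit → ℚ
ceiling ms = 1ℚ + maxIndex ms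

maxIndex-nonneg : ∀ ms → 0ℚ ≤ maxIndex ms
maxIndex-nonneg []       = ℚ.≤-refl
maxIndex-nonneg (m ∷ ms) = ℚ.p≤q⇒p≤r⊔q (val (index m)) (maxIndex-nonneg ms)

maxIndex-≥ : ∀ ms j → val (index (List.lookup ms j)) ≤ maxIndex ms
maxIndex-≥ (m ∷ ms) zero    = ℚ.p≤p⊔q _ _
maxIndex-≥ (m ∷ ms) (suc j) = ℚ.p≤q⇒p≤r⊔q (val (index m)) (maxIndex-≥ ms j)

≤maxIndex⇒<ceiling : ∀ ms {x} → x ≤ maxIndex ms → x < ceiling ms
≤maxIndex⇒<ceiling ms {x} x≤max = ℚ.≤-<-trans x≤max
  (subst (_< ceiling ms) (ℚ.+-identityˡ (maxIndex ms)) (ℚ.+-monoˡ-< (maxIndex ms) (ℚ.positive⁻¹ 1ℚ)))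

index<ceiling : ∀ ms j → val (index (List.lookup ms j)) < ceiling ms
index<ceiling ms j = ≤maxIndex⇒<ceiling ms (maxIndex-≥ ms j)

0<ceiling : ∀ ms → 0ℚ < ceiling ms
0<ceiling ms = ≤maxIndex⇒<ceiling ms (maxIndex-nonneg ms)


-- The root of the
-- candidate model is labelled by the positive atoms of D; for every usable
-- cell σ of the modal literals of D it has two children, both a model of
-- the cell, weighted by the tightest lower and upper bound σ imposes.
-- Each literal of D either holds at the root, or its failure yields a
-- refutation of D.
module Construction (D : List Lit) (d : ℕ) (decide< : ∀ φ → depth φ <ℕ d → Verdict φ)
                    (shallow : ∀ {x} → x ∈ D → litDepth x ≤ℕ d) where

  G : Form
  G = conj D

  ms : List MLit
  ms = modalLits D

  k : ℕ
  k = List.length ms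

  asserts : ∀ j {m} → List.lookup ms j ≡ m → G ⊩ mlitF m
  asserts j refl = conj-elim D (modalLits⁻ D (∈-lookup j))

  -- cells are decided by the procedure for shallower formulae; the cell of
  -- the empty list of literals is the trivially satisfiable ⊤F
  verdictFor : (ns : List MLit) → (∀ j → depth (argAt ns j) <ℕ d) → (σ : Cell ns) → Verdict (χ ns σ)
  verdictFor []       _         []  = model leaf (⊨-⊤F leaf)
  verdictFor (m ∷ ns) shallowAt σ =
    decide< (χ (m ∷ ns) σ)
      (χ-depth (m ∷ ns) σ shallowAt (ℕ.≤-trans (ℕ.s≤s ℕ.z≤n) (shallowAt zero)))

  verdict : (σ : Cell ms) → Verdict (χ ms σ)
  verdict = verdictFor ms (λ j → shallow (modalLits⁻ D (∈-lookup j)))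

  cellTree : Cell ms → Tree
  cellTree σ = treeOf (verdict σ)

  χ-proves-at : ∀ {σ j m} → j ∈ₛ σ → List.lookup ms j ≡ m → ⊢ imp (χ ms σ) (arg m)
  χ-proves-at j∈σ refl = χ-proves ms j∈σ

  -- the tightest κ-bound imposed by a cell (0, resp. the ceiling, if none)
  default : Kind → ℚ
  default lower = 0ℚ
  default upper = ceiling ms

  -- Opaque: only tightest-respects and tightest-attained are used about it,
  -- which also keeps the rational arithmetic from being normalised.
  opaque
    tightest : Kind → Cell ms → ℚ
    tightest lower σ = Extrema.max 0ℚ (List.map val (imposedBy lower ms σ))
    tightest upper σ = Extrema.min (ceiling ms) (List.map val (imposedBy upper ms σ))

    tightest-respects : ∀ κ σ {j r ψ} → j ∈ₛ σ → List.lookup ms j ≡ bound κ r ψ →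
                        val r ≼⟨ κ ⟩ tightest κ σ
    tightest-respects lower σ j∈σ m≡ =
      All.lookup (Extrema.xs≤max 0ℚ _) (∈-map⁺ val (imposedBy⁺ lower ms j∈σ m≡))
    tightest-respects upper σ j∈σ m≡ =
      All.lookup (Extrema.min≤xs (ceiling ms) _) (∈-map⁺ val (imposedBy⁺ upper ms j∈σ m≡))

  Attained : Kind → Cell ms → Set
  Attained κ σ = Σ[ r ∈ ℚ≥0 ] (ImposedAt κ ms σ r × tightest κ σ ≡ val r)

  opaque
    unfolding tightest
    tightest-attained : ∀ κ σ → tightest κ σ ≡ default κ ⊎ Attained κ σ
    tightest-attained lower σ with Extrema.argmax-sel id 0ℚ (List.map val (imposedBy lower ms σ))
    ... | inj₁ ≡default = inj₁ ≡default
    ... | inj₂ ∈imposed =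
      let r , r∈ , ≡r = ∈-map⁻ val ∈imposed in inj₂ (r , imposedBy⁻ lower ms r∈ , ≡r)
    tightest-attained upper σ with Extrema.argmin-sel id (ceiling ms) (List.map val (imposedBy upper ms σ))
    ... | inj₁ ≡default = inj₁ ≡default
    ... | inj₂ ∈imposed =
      let r , r∈ , ≡r = ∈-map⁻ val ∈imposed in inj₂ (r , imposedBy⁻ upper ms r∈ , ≡r)

  attained-index : ∀ κ σ → (a : Attained κ σ) → val (proj₁ a) < ceiling ms
  attained-index κ σ (r , (j , ψ , _ , m≡) , _) =
    subst (λ m → val (index m) < ceiling ms) m≡ (index<ceiling ms j)

  tightest-nonneg : ∀ κ σ → 0ℚ ≤ tightest κ σ
  tightest-nonneg κ σ with tightest-attained κ σ
  tightest-nonneg lower σ | inj₁ ≡0    = ℚ.≤-reflexive (sym ≡0)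
  tightest-nonneg upper σ | inj₁ ≡ceil = subst (0ℚ ≤_) (sym ≡ceil) (ℚ.<⇒≤ (0<ceiling ms))
  tightest-nonneg κ     σ | inj₂ (r , _ , ≡r) = subst (0ℚ ≤_) (sym ≡r) (proj₂ r)

  tightest-lower<ceiling : ∀ σ → tightest lower σ < ceiling ms
  tightest-lower<ceiling σ with tightest-attained lower σ
  ... | inj₁ ≡0 = subst (_< ceiling ms) (sym ≡0) (0<ceiling ms)
  ... | inj₂ a@(r , _ , ≡r) = subst (_< ceiling ms) (sym ≡r) (attained-index lower σ a)

  -- a cell asserting the argument of a literal  ¬L0 ψ  must stay empty
  IsVoid : MLit → Set
  IsVoid m = Σ[ ψ ∈ Form ] (m ≡ void ψ)

  isVoid? : ∀ m → Dec (IsVoid m)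
  isVoid? (bound _ _ _)   = no λ ()
  isVoid? (unbound _ _ _) = no λ ()
  isVoid? (void ψ)        = yes (ψ , refl)

  VoidActive : Cell ms → Set
  VoidActive σ = ∃ λ j → j ∈ₛ σ × IsVoid (List.lookup ms j)

  Usable : Cell ms → Set
  Usable σ = Satisfiable (verdict σ) × ¬ VoidActive σ × tightest lower σ ≤ tightest upper σ

  usable? : ∀ σ → Dec (Usable σ)
  usable? σ = satisfiable? (verdict σ)
         ×-dec ¬? (Fin.any? (λ j → j ∈ₛ? σ ×-dec isVoid? (List.lookup ms j)))
         ×-dec tightest lower σ ℚ.≤? tightest upper σ

  cellTree-⊨ : ∀ {σ} → Usable σ → cellTree σ ⊨ᵗ χ ms σ
  cellTree-⊨ {σ} (sat , _) = treeOf-⊨ (verdict σ) sat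

  cellTree-⊨-at : ∀ {σ j m} → Usable σ → j ∈ₛ σ → List.lookup ms j ≡ m → cellTree σ ⊨ᵗ arg m
  cellTree-⊨-at u j∈σ refl = χ-in ms (cellTree-⊨ u) j∈σ

  -- a cell whose lower bound exceeds its upper bound has no successors:
  -- both bounds are imposed by literals L r₁ ψ₁ and M r₂ ψ₂ of D with
  -- r₂ < r₁, which pass to the cell and contradict each other by A6
  crossed-void : ∀ σ → tightest upper σ < tightest lower σ → G ⊩ neg (L0 (χ ms σ))
  crossed-void σ hi<lo with tightest-attained lower σ | tightest-attained upper σ
  ... | inj₁ lo≡0 | _ =
    ⊥-elim (ℚ.<-irrefl refl
      (ℚ.<-≤-trans (subst (tightest upper σ <_) lo≡0 hi<lo) (tightest-nonneg upper σ)))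
  ... | inj₂ _ | inj₁ hi≡ceil =
    ⊥-elim (ℚ.<-irrefl refl
      (ℚ.<-trans (subst (_< tightest lower σ) hi≡ceil hi<lo) (tightest-lower<ceiling σ)))
  ... | inj₂ (r₁ , (j₁ , ψ₁ , j₁∈σ , m₁≡) , lo≡r₁)
      | inj₂ (r₂ , (j₂ , ψ₂ , j₂∈σ , m₂≡) , hi≡r₂) =
    byTaut (v 0 ⇒ v 1 ∷ v 0 ⇒ v 2 ∷ v 1 ∧ˢ v 3 ⇒ v 4 ∷ v 2 ∧ˢ v 3 ⇒ v 5 ∷
            v 4 ⇒ ¬ˢ v 5 ∷ [])
      (v 0 ⇒ ¬ˢ v 3)
      (G ∷ L r₁ ψ₁ ∷ M r₂ ψ₂ ∷ L0 X ∷ L r₁ X ∷ M r₂ X ∷ [])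
      (asserts j₁ m₁≡ ∷ asserts j₂ m₂≡ ∷
       K-restrict lower r₁ (χ-proves-at j₁∈σ m₁≡) ∷
       K-restrict upper r₂ (χ-proves-at j₂∈σ m₂≡) ∷
       LM-exclusive X (subst₂ _<_ hi≡r₂ lo≡r₁ hi<lo) ∷ [])
    where X = χ ms σ

  cell-void : ∀ σ → ¬ Usable σ → G ⊩ neg (L0 (χ ms σ))
  cell-void σ unusable
    with satisfiable? (verdict σ)
       | Fin.any? (λ j → j ∈ₛ? σ ×-dec isVoid? (List.lookup ms j))
       | tightest lower σ ℚ.≤? tightest upper σ
  ... | no unsat | _ | _ = weaken (L0-refute (refutation (verdict σ) unsat))
  ... | yes _ | yes (j , j∈σ , ψ , m≡) | _ =
    byTaut (v 0 ⇒ ¬ˢ v 1 ∷ v 2 ⇒ v 1 ∷ []) (v 0 ⇒ ¬ˢ v 2) (G ∷ L0 ψ ∷ L0 (χ ms σ) ∷ [])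
      (asserts j m≡ ∷ R2 z0 refl (χ-proves-at j∈σ m≡) ∷ [])
  ... | yes _ | no _ | no lo≰hi = crossed-void σ (ℚ.≰⇒> lo≰hi)
  ... | yes sat | no inactive | yes lo≤hi = ⊥-elim (unusable (sat , inactive , lo≤hi))

  -- a cell whose tightest κ-bound respects r < ceiling has no successors or
  -- satisfies K κ r: the tightest bound is imposed by a literal K κ r′ ψ
  -- of D, which passes to the cell (a default bound is trivial or impossible)
  respects-bound : ∀ κ r σ → val r < ceiling ms → val r ≼⟨ κ ⟩ tightest κ σ →
                   G ⊩ or (neg (L0 (χ ms σ))) (K κ r (χ ms σ))
  respects-bound κ r σ r<ceil r≼ with tightest-attained κ σ
  respects-bound lower r σ r<ceil r≤0 | inj₁ ≡0
    with index-≡ {r} {z0} (ℚ.≤-antisym (subst (val r ≤_) ≡0 r≤0) (proj₂ r))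
  ... | refl = byTaut [] (v 0 ⇒ ¬ˢ v 1 ∨ˢ v 1) (G ∷ L0 (χ ms σ) ∷ []) []
  respects-bound upper r σ r<ceil ceil≤r | inj₁ ≡ceil =
    ⊥-elim (ℚ.<-irrefl refl (ℚ.<-≤-trans r<ceil (subst (_≤ val r) ≡ceil ceil≤r)))
  respects-bound κ r σ r<ceil r≼ | inj₂ (r′ , (j , ψ , j∈σ , m≡) , ≡r′) =
    byTaut (v 0 ⇒ v 1 ∷ v 1 ∧ˢ v 2 ⇒ v 3 ∷ v 3 ⇒ v 4 ∷ []) (v 0 ⇒ ¬ˢ v 2 ∨ˢ v 4)
      (G ∷ K κ r′ ψ ∷ L0 X ∷ K κ r′ X ∷ K κ r X ∷ [])
      (asserts j m≡ ∷ K-restrict κ r′ (χ-proves-at j∈σ m≡) ∷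
       K-weaken κ X (subst (val r ≼⟨ κ ⟩_) ≡r′ r≼) ∷ [])
    where X = χ ms σ

  weight : Kind → Cell ms → ℚ≥0
  weight κ σ = tightest κ σ , tightest-nonneg κ σ

  childrenIf : ∀ σ → Dec (Usable σ) → List (ℚ≥0 × Tree)
  childrenIf σ (yes _) = (weight lower σ , cellTree σ) ∷ (weight upper σ , cellTree σ) ∷ []
  childrenIf σ (no _)  = []

  -- Opaque: only weight-child and child-origin are used about it.
  opaque
    rootChildren : List (ℚ≥0 × Tree)
    rootChildren = List.concatMap (λ σ → childrenIf σ (usable? σ)) (allSubsets k)

  root : Tree
  root = node (λ p → does (p ∈ℕ? posAtoms D)) rootChildren

  Within : Cell ms → ℚ → Set
  Within σ w = ∀ κ → tightest κ σ ≼⟨ κ ⟩ w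

  Origin : ℚ≥0 → Tree → Set
  Origin w t = Σ[ σ ∈ Cell ms ] (Usable σ × t ≡ cellTree σ × Within σ (val w))

  opaque
    unfolding rootChildren

    weight-child : ∀ κ σ → Usable σ → (weight κ σ , cellTree σ) ∈ rootChildren
    weight-child κ σ u = ∈-concatMap⁺ (λ σ → childrenIf σ (usable? σ))
      (lose (allSubsets-complete σ) (in-cell κ (usable? σ)))
      where
      in-cell : ∀ κ u? → (weight κ σ , cellTree σ) ∈ childrenIf σ u?
      in-cell lower (yes _) = here refl
      in-cell upper (yes _) = there (here refl)
      in-cell κ     (no ¬u) = ⊥-elim (¬u u)

    child-origin : ∀ {w t} → (w , t) ∈ rootChildren → Origin w t
    child-origin e∈
      with Any.satisfied (∈-concatMap⁻ (λ σ → childrenIf σ (usable? σ)) {xs = allSubsets k} e∈)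
    ... | σ , e∈σ = from-cell σ (usable? σ) e∈σ
      where
      from-cell : ∀ σ u? {w t} → (w , t) ∈ childrenIf σ u? → Origin w t
      from-cell σ (yes u@(_ , _ , lo≤hi)) (here refl) =
        σ , u , refl , λ { lower → ℚ.≤-refl ; upper → lo≤hi }
      from-cell σ (yes u@(_ , _ , lo≤hi)) (there (here refl)) =
        σ , u , refl , λ { lower → lo≤hi ; upper → ℚ.≤-refl }

  child-cell : ∀ j {m w t} → List.lookup ms j ≡ m → (w , t) ∈ rootChildren → t ⊨ᵗ arg m →
               Σ[ σ ∈ Cell ms ] (Usable σ × j ∈ₛ σ × Within σ (val w))
  child-cell j refl e∈ t⊨ψ with child-origin e∈
  ... | σ , u , refl , within = locate (j ∈ₛ? σ)
    where
    locate : Dec (j ∈ₛ σ) → Σ[ σ ∈ Cell ms ] (Usable σ × j ∈ₛ σ × Within σ _)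
    locate (yes j∈σ) = σ , u , j∈σ , within
    locate (no j∉σ)  = ⊥-elim (χ-out ms (cellTree-⊨ u) j∉σ t⊨ψ)

  search : ∀ {P : Cell ms → Set} → (∀ σ → Dec (P σ)) → ∃ P ⊎ (∀ σ → ¬ P σ)
  search P? with anySubset? P?
  ... | yes found = inj₁ found
  ... | no none   = inj₂ λ σ p → none (σ , p)

  Cover : Fin k → Form
  Cover j = ⋁ (List.map (χ ms) (cellsWith ms j))

  cover-at : ∀ j {m} → List.lookup ms j ≡ m → ⊢ imp (arg m) (Cover j)
  cover-at j refl = cover ms j

  cellsWith-∋ : ∀ j {X} → X ∈ List.map (χ ms) (cellsWith ms j) →
                Σ[ σ ∈ Cell ms ] (j ∈ₛ σ × X ≡ χ ms σ)
  cellsWith-∋ j X∈ with ∈-map⁻ (χ ms) X∈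
  ... | σ , σ∈ , refl = σ , proj₂ (∈-filter⁻ (j ∈ₛ?_) {xs = allSubsets k} σ∈) , refl

  cells-void : ∀ j → (∀ σ → ¬ (Usable σ × j ∈ₛ σ)) → G ⊩ neg (L0 (Cover j))
  cells-void j none = ⋁-void G _ λ X∈ → case cellsWith-∋ j X∈ of λ where
    (σ , j∈σ , refl) → cell-void σ (λ u → none σ (u , j∈σ))

  cells-bound : ∀ κ r j → val r < ceiling ms →
                (∀ σ → Usable σ → j ∈ₛ σ → val r ≼⟨ κ ⟩ tightest κ σ) →
                G ⊩ or (neg (L0 (Cover j))) (K κ r (Cover j))
  cells-bound κ r j r<ceil respected = ⋁-bound κ G r _ λ X∈ → case cellsWith-∋ j X∈ of λ where
    (σ , j∈σ , refl) → case usable? σ of λ where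
      (yes u)  → respects-bound κ r σ r<ceil (respected σ u j∈σ)
      (no ¬u) → ⊩-inl (cell-void σ ¬u)

  -- K κ r ψ holds at the root if some usable cell asserts ψ (all cells
  -- asserting ψ respect the bound); otherwise ψ has no successors, refuting D
  check-bound : ∀ κ r ψ j → List.lookup ms j ≡ bound κ r ψ → root ⊨ᵗ K κ r ψ ⊎ G ⊩ fls
  check-bound κ r ψ j m≡ with search (λ σ → usable? σ ×-dec j ∈ₛ? σ)
  ... | inj₁ (σ , u , j∈σ) = inj₁ (graded-K κ (witness , respected))
    where
    witness = (weight lower σ , cellTree σ) , weight-child lower σ u , cellTree-⊨-at u j∈σ m≡
    respected : ∀ e → e ∈ rootChildren → proj₂ e ⊨ᵗ ψ → val r ≼⟨ κ ⟩ val (proj₁ e)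
    respected (w , t) e∈ t⊨ψ with child-cell j m≡ e∈ t⊨ψ
    ... | σ′ , _ , j∈σ′ , within = ≼-trans κ (tightest-respects κ σ′ j∈σ′ m≡) (within κ)
  ... | inj₂ none =
    inj₂ (refute-void (⊩-mp (K-L0 κ r ψ) (asserts j m≡)) (cover-at j m≡) (cells-void j none))

  -- L0 ψ ∧ ¬K κ r ψ holds at the root if some usable cell asserting ψ has
  -- its tightest bound violating r; otherwise all respect r, refuting D
  check-unbound : ∀ κ r ψ j → List.lookup ms j ≡ unbound κ r ψ →
                  root ⊨ᵗ and (L0 ψ) (neg (K κ r ψ)) ⊎ G ⊩ fls
  check-unbound κ r ψ j m≡
    with search (λ σ → usable? σ ×-dec j ∈ₛ? σ ×-dec ¬? (≼-dec κ (val r) (tightest κ σ)))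
  ... | inj₁ (σ , u , j∈σ , violated) = inj₁ (L0-intro {t = root} child ⊨ψ , λ ⊨K →
          violated (proj₂ (K-graded κ ⊨K) _ child ⊨ψ))
    where
    child = weight-child κ σ u
    ⊨ψ = cellTree-⊨-at u j∈σ m≡
  ... | inj₂ none = inj₂ (refute-bound κ r (⊩-fst G⊩) (⊩-snd G⊩) (cover-at j m≡)
                          (cells-bound κ r j r<ceil respected))
    where
    G⊩ = asserts j m≡
    r<ceil = subst (λ m → val (index m) < ceiling ms) m≡ (index<ceiling ms j)
    respected : ∀ σ → Usable σ → j ∈ₛ σ → val r ≼⟨ κ ⟩ tightest κ σ
    respected σ u j∈σ = decidable-stable (≼-dec κ _ _) λ violated → none σ (u , j∈σ , violated)

  -- ¬L0 ψ always holds at the root: usable cells do not assert ψ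
  check-void : ∀ ψ j → List.lookup ms j ≡ void ψ → root ⊨ᵗ neg (L0 ψ)
  check-void ψ j m≡ (((w , t) , e∈ , t⊨ψ) , _) with child-cell j m≡ e∈ t⊨ψ
  ... | σ , (_ , inactive , _) , j∈σ , _ = inactive (j , j∈σ , ψ , m≡)

  check-modal : ∀ j → root ⊨ᵗ mlitF (List.lookup ms j) ⊎ G ⊩ fls
  check-modal j with List.lookup ms j in m≡
  ... | bound κ r ψ   = check-bound κ r ψ j m≡
  ... | unbound κ r ψ = check-unbound κ r ψ j m≡
  ... | void ψ        = inj₁ (check-void ψ j m≡)

  check-literal : ∀ {x} → x ∈ D → root ⊨ᵗ litF x ⊎ G ⊩ fls
  check-literal {posAtom p} x∈ = inj₁ (dec-true (p ∈ℕ? posAtoms D) (posAtoms⁺ D x∈))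
  check-literal {negAtom p} x∈ with p ∈ℕ? posAtoms D
  ... | yes p∈ = inj₂ (⊩-contra (conj-elim D (posAtoms⁻ D p∈)) (conj-elim D x∈))
  ... | no _   = inj₁ λ ()
  check-literal {modal m} x∈ =
    subst (λ m → root ⊨ᵗ mlitF m ⊎ G ⊩ fls) (sym (lookup-index m∈)) (check-modal (Any.index m∈))
    where m∈ = modalLits⁺ D x∈

  decide-conj : Verdict G
  decide-conj with conj-intro root D check-literal
  ... | inj₁ root⊨D = model root root⊨D
  ... | inj₂ G⊩fls  = refuted (⊩-refute G⊩fls)

first-model : ∀ Ds → (∀ {D} → D ∈ Ds → Verdict (conj D)) →
              (Σ[ D ∈ List Lit ] (D ∈ Ds × Σ[ t ∈ Tree ] t ⊨ᵗ conj D)) ⊎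
              (∀ {D} → D ∈ Ds → ⊢ neg (conj D))
first-model []       _      = inj₂ λ ()
first-model (D ∷ Ds) decide with decide (here refl) | first-model Ds (decide ∘ there)
... | model t t⊨D | _                       = inj₁ (D , here refl , t , t⊨D)
... | refuted _    | inj₁ (E , E∈ , found) = inj₁ (E , there E∈ , found)
... | refuted ⊢¬D  | inj₂ ⊢¬Ds             =
  inj₂ λ { (here refl) → ⊢¬D ; (there E∈) → ⊢¬Ds E∈ }

decide-step : ∀ φ → (∀ ψ → depth ψ <ℕ depth φ → Verdict ψ) → Verdict φ
decide-step φ decide<
  with first-model (dnf⁺ φ) (λ D∈ → Construction.decide-conj _ (depth φ) decide< (dnf⁺-depth φ D∈))
... | inj₁ (D , D∈ , t , t⊨D) = model t (dnf⁺-sound φ D∈ t⊨D)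
... | inj₂ ⊢¬Ds               = refuted (dnf-refute φ ⊢¬Ds)

decide : ∀ φ → Verdict φ
decide φ = decide-below (suc (depth φ)) φ ℕ.≤-refl
  where
  decide-below : ∀ d φ → depth φ <ℕ d → Verdict φ
  decide-below (suc d) φ (ℕ.s≤s φ≤d) =
    decide-step φ λ ψ ψ<φ → decide-below d ψ (ℕ.<-≤-trans ψ<φ φ≤d)

-- Flattening a tree into a finite WTS whose states are its subtrees.
subtrees : Tree → List Tree
descendants : List (ℚ≥0 × Tree) → List Tree
subtrees (node ℓ cs) = node ℓ cs ∷ descendants cs
descendants []             = []
descendants ((_ , u) ∷ cs) = subtrees u ++ descendants cs

rootIndex : ∀ t → Fin (List.length (subtrees t))
rootIndex (node _ _) = zero

lookup-root : ∀ t → List.lookup (subtrees t) (rootIndex t) ≡ t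
lookup-root (node _ _) = refl

subtrees-closed : ∀ t {u e} → u ∈ subtrees t → e ∈ children u → proj₂ e ∈ subtrees t
descendants-closed : ∀ cs {u e} → u ∈ descendants cs → e ∈ children u → proj₂ e ∈ descendants cs
subtrees-closed (node ℓ cs) (here refl) e∈ = there (child∈ cs e∈)
  where
  child∈ : ∀ cs {e} → e ∈ cs → proj₂ e ∈ descendants cs
  child∈ ((_ , node _ _) ∷ cs) (here refl) = here refl
  child∈ ((_ , u) ∷ cs)        (there e∈)  = ∈-++⁺ʳ (subtrees u) (child∈ cs e∈)
subtrees-closed (node ℓ cs) (there u∈) e∈ = there (descendants-closed cs u∈ e∈)
descendants-closed ((_ , u) ∷ cs) u′∈ e∈ with ∈-++⁻ (subtrees u) u′∈
... | inj₁ u′∈u  = ∈-++⁺ˡ (subtrees-closed u u′∈u e∈)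
... | inj₂ u′∈cs = ∈-++⁺ʳ (subtrees u) (descendants-closed cs u′∈cs e∈)

module Flatten (t : Tree) where

  at : Fin (List.length (subtrees t)) → Tree
  at = List.lookup (subtrees t)

  wts : FinWTS
  wts = record
    { n       = List.length (subtrees t)
    ; _─[_]→_ = λ i w j → Σ[ q ∈ ℚ≥0 ] (w ≡ val q × (q , at j) ∈ children (at i))
    ; nonneg  = λ { (q , refl , _) → proj₂ q }
    ; ℓ       = λ i → label (at i)
    }

  locate : ∀ i {e} → e ∈ children (at i) →
           Σ[ j ∈ Fin (n wts) ] (at j ≡ proj₂ e × _─[_]→_ wts i (val (proj₁ e)) j)
  locate i {q , u} e∈ =
    let u∈ = subtrees-closed t (∈-lookup i) e∈
    in  Any.index u∈ , sym (lookup-index u∈) ,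
        (q , refl , subst (λ u → (q , u) ∈ children (at i)) (lookup-index u∈) e∈)

  WGraded : (Fin (n wts) → Set) → (ℚ → Set) → Fin (n wts) → Set
  WGraded P R i = (Σ[ j ∈ Fin (n wts) ] Σ[ w ∈ ℚ ] (_─[_]→_ wts i w j × P j)) ×
                  (∀ j w → _─[_]→_ wts i w j → P j → R w)

  graded-to : ∀ {P Q R} i → (∀ j → P j → Q (at j)) → (∀ j → Q (at j) → P j) →
              WGraded P R i → Graded Q R (at i)
  graded-to {Q = Q} i P⇒Q Q⇒P ((j , _ , (q , refl , q∈) , Pj) , all) =
    ((q , at j) , q∈ , P⇒Q j Pj) , λ e e∈ Qe →
      let j′ , at≡ , edge = locate i e∈ in all j′ _ edge (Q⇒P j′ (subst Q (sym at≡) Qe))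

  graded-from : ∀ {P Q R} i → (∀ j → P j → Q (at j)) → (∀ j → Q (at j) → P j) →
                Graded Q R (at i) → WGraded P R i
  graded-from {Q = Q} i P⇒Q Q⇒P ((e , e∈ , Qe) , all) =
    let j , at≡ , edge = locate i e∈ in
    (j , _ , edge , Q⇒P j (subst Q (sym at≡) Qe)) ,
    λ { j′ _ (q , refl , q∈) Pj′ → all (q , at j′) q∈ (P⇒Q j′ Pj′) }

  transfer : ∀ φ i → (wts ∣ i ⊨ φ → at i ⊨ᵗ φ) × (at i ⊨ᵗ φ → wts ∣ i ⊨ φ)
  transfer (atom p)  i = id , id
  transfer (neg φ)   i = (λ ¬⊨ ⊨ → ¬⊨ (proj₂ (transfer φ i) ⊨)) ,
                         (λ ¬⊨ ⊨ → ¬⊨ (proj₁ (transfer φ i) ⊨))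
  transfer (and φ ψ) i = (λ (⊨φ , ⊨ψ) → proj₁ (transfer φ i) ⊨φ , proj₁ (transfer ψ i) ⊨ψ) ,
                         (λ (⊨φ , ⊨ψ) → proj₂ (transfer φ i) ⊨φ , proj₂ (transfer ψ i) ⊨ψ)
  transfer (L r φ)   i = graded-to i (proj₁ ∘ transfer φ) (proj₂ ∘ transfer φ) ,
                         graded-from i (proj₁ ∘ transfer φ) (proj₂ ∘ transfer φ)
  transfer (M r φ)   i = graded-to i (proj₁ ∘ transfer φ) (proj₂ ∘ transfer φ) ,
                         graded-from i (proj₁ ∘ transfer φ) (proj₂ ∘ transfer φ)

theorem4p9 : (φ : Form) → Consistent φ →
    Σ[ 𝓜 ∈ FinWTS ] Σ[ s ∈ Fin (n 𝓜) ] (𝓜 ∣ s ⊨ φ)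
theorem4p9 φ consistent with decide φ
... | model t t⊨φ = Flatten.wts t , rootIndex t ,
                    proj₂ (Flatten.transfer t φ (rootIndex t)) (subst (_⊨ᵗ φ) (sym (lookup-root t)) t⊨φ)
... | refuted ⊢¬φ = ⊥-elim (consistent ⊢¬φ)
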